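{- Let $X$ be a non-empty set of positive integers with $X\neq\{1\}$. Both graphs $\Gamma(X)$ and $\Delta(X)$ are trees if and only if either $B(X)$ is a path or $B(X)\cong C_4$.
   Context: For a non-empty set $X$ of positive integers, $\rho(X)$ is the set of primes dividing some element of $X$ and $X^*=X\setminus\{1\}$. $B(X)$ is the bipartite graph with vertex set the disjoint union $\rho(X)\cup X^*$ and edges $\{p,x\}$ for $p\in\rho(X)$, $x\in X^*$, $p\mid x$. $\Delta(X)$ has vertex set $\rho(X)$, distinct $p,q$ adjacent iff $pq$ divides some element of $X$. $\Gamma(X)$ has vertex set $X^*$, distinct $x,y$ adjacent iff $\gcd(x,y)>1$. A tree is a connected acyclic graph; $C_4$ is the cycle on $4$ vertices. -}

module Defs where

open import Data.Nat using (ℕ; zero; suc; _+_; _*_; _<_; _≤_; _%_)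
open import Data.Nat.Divisibility using (_∣_)
open import Data.Nat.GCD using (gcd)
open import Data.Nat.Primality using (Prime)
open import Data.Fin using (Fin; toℕ)
open import Data.List using (List; []; _∷_; length; _∷ʳ_)
open import Data.List.Membership.Propositional using (_∈_)
open import Data.List.Relation.Unary.All using (All)
open import Data.List.Relation.Unary.Linked using (Linked)
open import Data.List.Relation.Unary.Unique.Propositional using (Unique)
open import Data.Sum using (_⊎_; inj₁; inj₂)
open import Data.Product using (Σ; ∃; _×_; _,_)
open import Data.Empty using (⊥)
open import Relation.Nullary using (¬_)
open import Relation.Binary.PropositionalEquality using (_≡_; _≢_)

-- A (simple) graph whose vertices are the elements of a carrier C satisfying Vert;
-- vertex equality is propositional equality on C.  Adj is only consulted on vertices.
record Graph (C : Set) : Set₁ where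
  field
    Vert : C → Set
    Adj  : C → C → Set
open Graph public

data Walk {C : Set} (G : Graph C) : C → C → Set where
  here  : ∀ {v} → Vert G v → Walk G v v
  there : ∀ {u v w} → Vert G u → Adj G u v → Walk G v w → Walk G u w

Connected : {C : Set} → Graph C → Set
Connected G = ∀ u v → Vert G u → Vert G v → Walk G u v

Cycle : {C : Set} → Graph C → Set
Cycle {C} G = Σ C λ v → Σ (List C) λ vs →
  (3 ≤ length (v ∷ vs)) × Unique (v ∷ vs) × All (Vert G) (v ∷ vs)
  × Linked (Adj G) ((v ∷ vs) ∷ʳ v)

Acyclic : {C : Set} → Graph C → Set
Acyclic G = ¬ Cycle G

IsTree : {C : Set} → Graph C → Set
IsTree G = Connected G × Acyclic G

Iso : (n : ℕ) → (Fin n → Fin n → Set) → {C : Set} → Graph C → Set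
Iso n H {C} G = Σ (Fin n → C) λ f →
  (∀ i j → f i ≡ f j → i ≡ j)
  × (∀ i → Vert G (f i))
  × (∀ v → Vert G v → ∃ λ i → f i ≡ v)
  × (∀ i j → H i j → Adj G (f i) (f j))
  × (∀ i j → Adj G (f i) (f j) → H i j)

PathAdj : (n : ℕ) → Fin n → Fin n → Set
PathAdj n i j = (suc (toℕ i) ≡ toℕ j) ⊎ (suc (toℕ j) ≡ toℕ i)

C4Adj : Fin 4 → Fin 4 → Set
C4Adj i j = (suc (toℕ i) % 4 ≡ toℕ j) ⊎ (suc (toℕ j) % 4 ≡ toℕ i)

IsPath : {C : Set} → Graph C → Set
IsPath G = ∃ λ n → Iso n (PathAdj n) G

IsoC4 : {C : Set} → Graph C → Set
IsoC4 G = Iso 4 C4Adj G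

-- the sets ρ(X) and X* for a finite set X given as a list
InRho : List ℕ → ℕ → Set
InRho X p = Prime p × ∃ λ x → x ∈ X × p ∣ x

InStar : List ℕ → ℕ → Set
InStar X x = x ∈ X × x ≢ 1

Δ : List ℕ → Graph ℕ
Δ X = record { Vert = InRho X
             ; Adj = λ p q → p ≢ q × ∃ λ x → x ∈ X × (p * q) ∣ x }

Γ : List ℕ → Graph ℕ
Γ X = record { Vert = InStar X
             ; Adj = λ x y → x ≢ y × 1 < gcd x y }

BVert : List ℕ → ℕ ⊎ ℕ → Set
BVert X (inj₁ p) = InRho X p
BVert X (inj₂ x) = InStar X x

BAdj : ℕ ⊎ ℕ → ℕ ⊎ ℕ → Set
BAdj (inj₁ p) (inj₂ x) = p ∣ x
BAdj (inj₂ x) (inj₁ p) = p ∣ x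
BAdj (inj₁ _) (inj₁ _) = ⊥
BAdj (inj₂ _) (inj₂ _) = ⊥

B : List ℕ → Graph (ℕ ⊎ ℕ)
B X = record { Vert = BVert X ; Adj = BAdj }

-- B(X) is bipartite, and its vertices of degree ≥ 3 and its long cycles are seen in Γ(X) and Δ(X):
-- three primes dividing one element x form a triangle of Δ(X), three elements sharing a prime p
-- form a triangle of Γ(X), and a cycle of length 2k ≥ 6 of B(X) runs through k ≥ 3 elements,
-- consecutive ones sharing a prime, i.e. a cycle of Γ(X).  Walks of Γ(X) lift to B(X).  Hence if
-- Γ(X) and Δ(X) are trees, B(X) is connected of maximum degree ≤ 2 with only 4-cycles; a maximal
-- path then spans B(X) and is either all of it or closes up into C₄.
-- Conversely, an edge of Γ(X) or Δ(X) is a walk of length two in B(X).  In a path such two-steps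
-- move the position by exactly ±2 and, along a cycle, never turn back, so they cannot return to
-- the start; in C₄ two steps lead to the opposite vertex, so a cycle would revisit its first vertex
-- after two edges.  Walks of B(X) between elements (or primes) project to Γ(X) (or Δ(X)).
module Submission where

open import Defs

open import Data.Nat using (ℕ; zero; suc; _+_; _*_; _%_; _<_; _≤_; _>_; _≤?_; _≟_; s≤s; z≤n; z<s; ≢-nonZero; >-nonZero; nonTrivial⇒n>1)
open import Data.Nat.DivMod using (m<n⇒m%n≡m)
open import Data.Nat.Divisibility using (_∣_; _∣?_; divides; ∣⇒≤; ∣1⇒≡1; ∣-trans; m*n∣⇒m∣; m*n∣⇒n∣)
open import Data.Nat.GCD using (gcd; gcd-greatest; gcd[m,n]∣m; gcd[m,n]∣n; gcd[m,n]≢0)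
open import Data.Nat.LCM using (lcm; lcm-least; gcd*lcm)
open import Data.Nat.Coprimality using (Coprime; coprime⇒gcd≡1)
open import Data.Nat.Primality using (Prime; prime?; prime⇒irreducible; prime⇒nonTrivial)
open import Data.Nat.Primality.Factorisation using (factorise)
open import Data.Nat.ListAction using (product)
open import Data.Nat.Properties
  using (≤-refl; ≤-trans; ≤-pred; <-trans; <-irrefl; <-pred; <-cmp; ≤-<-trans; n<1+n; n≮n; <⇒≢; <⇒≱; ≰⇒>; ≤∧≢⇒<;
         suc-injective; 0≢1+n; +-suc; m≤m+n; m<n+m; *-comm; *-identityˡ)
open import Data.Fin as Fin using (Fin; toℕ; fromℕ<)
open import Data.Fin.Patterns using (0F; 1F; 2F; 3F)
open import Data.Fin.Properties using (pigeonhole; toℕ-fromℕ<; fromℕ<-toℕ; toℕ-injective; toℕ<n)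
open import Data.List using (List; []; _∷_; length; _∷ʳ_; lookup; map; concatMap; upTo)
open import Data.List.Membership.Propositional using (_∈_; _∉_; lose; find)
open import Data.List.Membership.Propositional.Properties using (∈-lookup; ∈-map⁺; ∈-upTo⁺; ∈-concatMap⁺)
open import Data.List.Membership.DecPropositional _≟_ using () renaming (_∈?_ to _∈ℕ?_)
open import Data.List.Relation.Binary.Subset.Propositional using (_⊆_)
open import Data.List.Relation.Unary.Any using (Any; here; there; index; any?)
open import Data.List.Relation.Unary.Any.Properties using (lookup-index)
open import Data.List.Relation.Unary.All using (All; []; _∷_)
import Data.List.Relation.Unary.All as All
import Data.List.Relation.Unary.All.Properties as All
open import Data.List.Relation.Unary.All.Properties using (¬Any⇒All¬)
open import Data.List.Relation.Unary.AllPairs using ([]; _∷_)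
open import Data.List.Relation.Unary.Linked using (Linked; []; [-]; _∷_)
import Data.List.Relation.Unary.Linked as Linked
open import Data.List.Relation.Unary.Linked.Properties using (AllPairs⇒Linked; Linked⇒AllPairs)
open import Data.List.Relation.Unary.Unique.Propositional using (Unique)
import Data.List.Relation.Unary.Unique.Propositional.Properties as Unique
open import Data.Empty using (⊥; ⊥-elim)
open import Data.Unit using (⊤)
open import Data.Product using (∃; _×_; _,_; proj₁; proj₂)
open import Data.Sum using (_⊎_; inj₁; inj₂)
import Data.Sum as Sum
open import Data.Sum.Properties using (≡-dec; inj₁-injective; inj₂-injective)
open import Function using (id; _∘_; flip)
open import Relation.Binary.Definitions using (DecidableEquality; tri<; tri≈; tri>)
open import Relation.Nullary using (¬_; Dec; yes; no)
open import Relation.Nullary.Decidable using (_×-dec_; ¬?; map′)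
open import Relation.Binary.PropositionalEquality using (_≡_; _≢_; refl; sym; trans; cong; subst; subst₂; module ≡-Reasoning)
open ≡-Reasoning

module _ {A : Set} where

  lookup-injective : ∀ {xs : List A} → Unique xs → ∀ i j → lookup xs i ≡ lookup xs j → i ≡ j
  lookup-injective (_ ∷ _)       Fin.zero    Fin.zero    _ = refl
  lookup-injective (x∉ ∷ _)      Fin.zero    (Fin.suc j) e = ⊥-elim (All.lookup x∉ (∈-lookup j) e)
  lookup-injective (x∉ ∷ _)      (Fin.suc i) Fin.zero    e = ⊥-elim (All.lookup x∉ (∈-lookup i) (sym e))
  lookup-injective (_ ∷ unique)  (Fin.suc i) (Fin.suc j) e = cong Fin.suc (lookup-injective unique i j e)

  ∈⇒lookup : ∀ {x} {xs : List A} → x ∈ xs → ∃ λ i → lookup xs i ≡ x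
  ∈⇒lookup x∈xs = index x∈xs , sym (lookup-index x∈xs)

  Linked⇒lookup : ∀ {R : A → A → Set} {xs} → Linked R xs → ∀ i j →
                  suc (toℕ i) ≡ toℕ j → R (lookup xs i) (lookup xs j)
  Linked⇒lookup (r ∷ _) Fin.zero    (Fin.suc Fin.zero) _ = r
  Linked⇒lookup (_ ∷ l) (Fin.suc i) (Fin.suc j)        e = Linked⇒lookup l i j (suc-injective e)
  Linked⇒lookup [-]     Fin.zero    Fin.zero           ()
  Linked⇒lookup (_ ∷ _) Fin.zero    Fin.zero           ()
  Linked⇒lookup (_ ∷ _) Fin.zero    (Fin.suc (Fin.suc _)) ()

  unique⊆⇒length≤ : ∀ {xs ys : List A} → Unique xs → xs ⊆ ys → length xs ≤ length ys
  unique⊆⇒length≤ {xs} {ys} unique xs⊆ys with length xs ≤? length ys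
  ... | yes le = le
  ... | no  gt with pigeonhole (≰⇒> gt) (λ i → index (xs⊆ys (∈-lookup i)))
  ...   | i , j , i<j , same = ⊥-elim (<⇒≢ i<j (cong toℕ (lookup-injective unique i j (begin
    lookup xs i                           ≡⟨ lookup-index (xs⊆ys (∈-lookup i)) ⟩
    lookup ys (index (xs⊆ys (∈-lookup i))) ≡⟨ cong (lookup ys) same ⟩
    lookup ys (index (xs⊆ys (∈-lookup j))) ≡⟨ sym (lookup-index (xs⊆ys (∈-lookup j))) ⟩
    lookup xs j                           ∎))))

  length-∷ʳ : ∀ (xs : List A) {y} → length (xs ∷ʳ y) ≡ suc (length xs)
  length-∷ʳ []       = refl
  length-∷ʳ (_ ∷ xs) = cong suc (length-∷ʳ xs)

  Unique-∷ʳ⁺ : ∀ {xs : List A} {y} → Unique xs → y ∉ xs → Unique (xs ∷ʳ y)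
  Unique-∷ʳ⁺ unique y∉xs = Unique.++⁺ unique ([] ∷ []) λ { (y∈xs , here refl) → y∉xs y∈xs }

  lastOf : A → List A → A
  lastOf h []      = h
  lastOf _ (x ∷ t) = lastOf x t

  lastOf-∷ʳ : ∀ (h : A) t {y} → lastOf h (t ∷ʳ y) ≡ y
  lastOf-∷ʳ h []      = refl
  lastOf-∷ʳ h (x ∷ t) = lastOf-∷ʳ x t

  lookup-head : ∀ (h : A) t {i} → toℕ i ≡ 0 → lookup (h ∷ t) i ≡ h
  lookup-head h t {Fin.zero}  _  = refl
  lookup-head h t {Fin.suc _} ()

  lookup-last : ∀ (h : A) t {i} → toℕ i ≡ length t → lookup (h ∷ t) i ≡ lastOf h t
  lookup-last h []      {Fin.zero}  _ = refl
  lookup-last h (x ∷ t) {Fin.suc i} e = lookup-last x t (suc-injective e)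

  Linked-∷ʳ⁺ : ∀ {R : A → A → Set} {h t y} → Linked R (h ∷ t) → R (lastOf h t) y →
               Linked R ((h ∷ t) ∷ʳ y)
  Linked-∷ʳ⁺ {t = []}    [-]     r = r ∷ [-]
  Linked-∷ʳ⁺ {t = _ ∷ _} (r′ ∷ l) r = r′ ∷ Linked-∷ʳ⁺ l r

  reduce-∷ʳ⁺ : ∀ {P : A → Set} {B : Set} (f : ∀ {x} → P x → B) {xs y} (pxs : All P xs) (py : P y) →
               All.reduce f (All.∷ʳ⁺ pxs py) ≡ All.reduce f pxs ∷ʳ f py
  reduce-∷ʳ⁺ f []         py = refl
  reduce-∷ʳ⁺ f (px ∷ pxs) py = cong (f px ∷_) (reduce-∷ʳ⁺ f pxs py)

  closed-distinct : ∀ {x} xs → Unique (x ∷ xs) → xs ≢ [] → Linked _≢_ ((x ∷ xs) ∷ʳ x)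
  closed-distinct []      _                     nonempty = ⊥-elim (nonempty refl)
  closed-distinct (a ∷ r) unique@((x≢a ∷ _) ∷ u) _       =
    x≢a ∷ AllPairs⇒Linked (Unique-∷ʳ⁺ u (Unique.Unique[x∷xs]⇒x∉xs unique))

  NonBacktracking : List A → Set
  NonBacktracking (a ∷ b ∷ c ∷ r) = a ≢ c × NonBacktracking (b ∷ c ∷ r)
  NonBacktracking _               = ⊤

  Unique⇒NonBacktracking : ∀ {xs} → Unique xs → NonBacktracking xs
  Unique⇒NonBacktracking []                          = _
  Unique⇒NonBacktracking (_ ∷ [])                    = _
  Unique⇒NonBacktracking (_ ∷ _ ∷ [])                = _
  Unique⇒NonBacktracking ((_ ∷ a≢c ∷ _) ∷ u@(_ ∷ _ ∷ _)) = a≢c , Unique⇒NonBacktracking u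

  closed-nonBacktracking : ∀ {x} xs → Unique (x ∷ xs) → 2 ≤ length xs →
                           NonBacktracking ((x ∷ xs) ∷ʳ x)
  closed-nonBacktracking (_ ∷ [])    _ (s≤s ())
  closed-nonBacktracking (a ∷ b ∷ r) unique@((_ ∷ x≢b ∷ _) ∷ u) _ =
    x≢b , Unique⇒NonBacktracking (Unique-∷ʳ⁺ u (Unique.Unique[x∷xs]⇒x∉xs unique))

module _ {C : Set} (G : Graph C) where

  SymmetricAdj : Set
  SymmetricAdj = ∀ {u v} → Adj G u v → Adj G v u

  IrreflexiveAdj : Set
  IrreflexiveAdj = ∀ {u} → ¬ Adj G u u

  Saturated : C → List C → Set
  Saturated v P = ∀ w → Vert G w → Adj G v w → w ∈ P

  MaxDegree≤2 : Set
  MaxDegree≤2 = ∀ {v a b c} → Vert G v → Vert G a → Vert G b → Vert G c →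
                Adj G v a → Adj G v b → Adj G v c → a ≢ b → a ≢ c → b ≢ c → ⊥

module _ {C : Set} {G : Graph C} where

  walk-start : ∀ {u v} → Walk G u v → Vert G u
  walk-start (here u)      = u
  walk-start (there u _ _) = u

  _++ʷ_ : ∀ {u v w} → Walk G u v → Walk G v w → Walk G u w
  here _        ++ʷ w′ = w′
  there u uv w  ++ʷ w′ = there u uv (w ++ʷ w′)

  reverseʷ : SymmetricAdj G → ∀ {u v} → Walk G u v → Walk G v u
  reverseʷ sym (here u)      = here u
  reverseʷ sym (there u uv w) = reverseʷ sym w ++ʷ there (walk-start w) (sym uv) (here u)

  triangle⇒Cycle : ∀ {a b c} → a ≢ b → a ≢ c → b ≢ c →
                   Vert G a → Vert G b → Vert G c → Adj G a b → Adj G b c → Adj G c a → Cycle G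
  triangle⇒Cycle a≢b a≢c b≢c a∈G b∈G c∈G ab bc ca =
    _ , _ ∷ _ ∷ [] , ≤-refl , (a≢b ∷ a≢c ∷ []) ∷ (b≢c ∷ []) ∷ [] ∷ [] ,
    a∈G ∷ b∈G ∷ c∈G ∷ [] , ab ∷ bc ∷ ca ∷ [-]

  cycle-length : Cycle G → ℕ
  cycle-length (v , vs , _) = length (v ∷ vs)

  rotate : ∀ {v w ws} → Unique (v ∷ w ∷ ws) → All (Vert G) (v ∷ w ∷ ws) →
           Linked (Adj G) ((v ∷ w ∷ ws) ∷ʳ v) →
           Unique (w ∷ ws ∷ʳ v) × All (Vert G) (w ∷ ws ∷ʳ v) × Linked (Adj G) ((w ∷ ws ∷ʳ v) ∷ʳ w)
  rotate {v} {w} {ws} unique@(_ ∷ unique′) (v∈G ∷ ws∈G) (vw ∷ closed) =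
    Unique-∷ʳ⁺ unique′ (Unique.Unique[x∷xs]⇒x∉xs unique) , All.∷ʳ⁺ ws∈G v∈G ,
    Linked-∷ʳ⁺ closed (subst (λ u → Adj G u w) (sym (lastOf-∷ʳ w ws)) vw)

-- The cycle C₄

EndPoints : ℕ → ℕ → ℕ → Set
EndPoints m a b = (a ≡ 0 × b ≡ m) ⊎ (b ≡ 0 × a ≡ m)

next : Fin 4 → Fin 4
next 0F = 1F
next 1F = 2F
next 2F = 3F
next 3F = 0F

toℕ-next : ∀ i → toℕ (next i) ≡ suc (toℕ i) % 4
toℕ-next 0F = refl
toℕ-next 1F = refl
toℕ-next 2F = refl
toℕ-next 3F = refl

next⁴≡id : ∀ i → next (next (next (next i))) ≡ i
next⁴≡id 0F = refl
next⁴≡id 1F = refl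
next⁴≡id 2F = refl
next⁴≡id 3F = refl

next-injective : ∀ {i j} → next i ≡ next j → i ≡ j
next-injective {i} {j} e = begin
  i                            ≡⟨ sym (next⁴≡id i) ⟩
  next (next (next (next i)))  ≡⟨ cong (λ k → next (next (next k))) e ⟩
  next (next (next (next j)))  ≡⟨ next⁴≡id j ⟩
  j                            ∎

C4Adj⇒next : ∀ {i j} → C4Adj i j → j ≡ next i ⊎ i ≡ next j
C4Adj⇒next {i} {j} (inj₁ e) = inj₁ (toℕ-injective (trans (sym e) (sym (toℕ-next i))))
C4Adj⇒next {i} {j} (inj₂ e) = inj₂ (toℕ-injective (trans (sym e) (sym (toℕ-next j))))

C4-common-neighbour : ∀ {a l b} → C4Adj a l → C4Adj l b → a ≢ b → b ≡ next (next a)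
C4-common-neighbour al lb a≢b with C4Adj⇒next al | C4Adj⇒next lb
... | inj₁ refl | inj₁ refl          = refl
... | inj₁ refl | inj₂ next-a≡next-b = ⊥-elim (a≢b (next-injective next-a≡next-b))
... | inj₂ refl | inj₁ b≡a          = ⊥-elim (a≢b (sym b≡a))
... | inj₂ refl | inj₂ refl          = sym (next⁴≡id _)

path-or-ends⇒C4Adj : ∀ {i j} → PathAdj 4 i j ⊎ EndPoints 3 (toℕ i) (toℕ j) → C4Adj i j
path-or-ends⇒C4Adj {i} {j} (inj₁ (inj₁ e)) = inj₁ (trans (cong (_% 4) e) (m<n⇒m%n≡m (toℕ<n j)))
path-or-ends⇒C4Adj {i} {j} (inj₁ (inj₂ e)) = inj₂ (trans (cong (_% 4) e) (m<n⇒m%n≡m (toℕ<n i)))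
path-or-ends⇒C4Adj (inj₂ (inj₁ (i≡0 , j≡3))) = inj₂ (trans (cong (λ k → suc k % 4) j≡3) (sym i≡0))
path-or-ends⇒C4Adj (inj₂ (inj₂ (j≡0 , i≡3))) = inj₁ (trans (cong (λ k → suc k % 4) i≡3) (sym j≡0))

-- Graphs that are paths or C₄

module _ {C : Set} {G : Graph C} (adj-sym : SymmetricAdj G) where

  private
    walk-from-first : ∀ {m} (f : Fin (suc m) → C) → (∀ i → Vert G (f i)) →
                      (∀ i j → PathAdj (suc m) i j → Adj G (f i) (f j)) → ∀ i → Walk G (f 0F) (f i)
    walk-from-first f f∈G f-adj 0F = here (f∈G 0F)
    walk-from-first {suc m} f f∈G f-adj (Fin.suc i) =
      there (f∈G 0F) (f-adj 0F 1F (inj₁ refl))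
            (walk-from-first (f ∘ Fin.suc) (f∈G ∘ Fin.suc)
                             (λ i j → f-adj (Fin.suc i) (Fin.suc j) ∘ Sum.map (cong suc) (cong suc)) i)

  traced-by-path⇒Connected : ∀ {m} (f : Fin (suc m) → C) → (∀ i → Vert G (f i)) →
                             (∀ v → Vert G v → ∃ λ i → f i ≡ v) →
                             (∀ i j → PathAdj (suc m) i j → Adj G (f i) (f j)) → Connected G
  traced-by-path⇒Connected f f∈G onto f-adj u v u∈G v∈G with onto u u∈G | onto v v∈G
  ... | i , refl | j , refl =
    reverseʷ adj-sym (walk-from-first f f∈G f-adj i) ++ʷ walk-from-first f f∈G f-adj j

  IsPath⇒Connected : IsPath G → Connected G
  IsPath⇒Connected (zero , _ , _ , _ , onto , _) u _ u∈G _ with () ← proj₁ (onto u u∈G)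
  IsPath⇒Connected (suc m , f , _ , f∈G , onto , f-adj , _) = traced-by-path⇒Connected f f∈G onto f-adj

  IsoC4⇒Connected : IsoC4 G → Connected G
  IsoC4⇒Connected (f , _ , f∈G , onto , f-adj , _) =
    traced-by-path⇒Connected f f∈G onto (λ i j → f-adj i j ∘ path-or-ends⇒C4Adj ∘ inj₁)

module _ {A : Set} {R : A → A → Set} (R-trans : ∀ {a b c} → R a b → R b c → R a c)
         (R-irrefl : ∀ {a} → ¬ R a a) where

  ¬Linked-closed : ∀ x xs → ¬ Linked R ((x ∷ xs) ∷ʳ x)
  ¬Linked-closed x xs chain with Linked⇒AllPairs R-trans chain
  ... | from-x ∷ _ = R-irrefl (proj₂ (All.∷ʳ⁻ from-x))

StepTwo : ℕ → ℕ → Set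
StepTwo a b = b ≡ 2 + a ⊎ a ≡ 2 + b

≡2+⇒< : ∀ {a b} → b ≡ 2 + a → a < b
≡2+⇒< refl = m<n+m _ z<s

StepTwo-monotone : ∀ {ks} → Linked StepTwo ks → NonBacktracking ks →
                   Linked (λ a b → b ≡ 2 + a) ks ⊎ Linked (λ a b → a ≡ 2 + b) ks
StepTwo-monotone []            _ = inj₁ []
StepTwo-monotone [-]           _ = inj₁ [-]
StepTwo-monotone (step ∷ [-]) _ = Sum.map (_∷ [-]) (_∷ [-]) step
StepTwo-monotone (step ∷ steps@(_ ∷ _)) (a≢c , nb) with StepTwo-monotone steps nb | step
... | inj₁ ups           | inj₁ up   = inj₁ (up ∷ ups)
... | inj₂ downs         | inj₂ down = inj₂ (down ∷ downs)
... | inj₁ (refl ∷ _)    | inj₂ refl = ⊥-elim (a≢c refl)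
... | inj₂ (refl ∷ _)    | inj₁ refl = ⊥-elim (a≢c refl)

StepTwo-not-closed : ∀ k ks → Linked StepTwo ((k ∷ ks) ∷ʳ k) → NonBacktracking ((k ∷ ks) ∷ʳ k) → ⊥
StepTwo-not-closed k ks steps nb with StepTwo-monotone steps nb
... | inj₁ ups   = ¬Linked-closed {R = _<_} <-trans (λ {a} → n≮n a) k ks (Linked.map ≡2+⇒< ups)
... | inj₂ downs = ¬Linked-closed {R = _>_} (flip <-trans) (λ {a} → n≮n a) k ks (Linked.map ≡2+⇒< downs)

module TwoStepEmbedding {C A : Set} {G : Graph C} {H : Graph A} (e : A → C)
  (e-injective : ∀ {a b} → e a ≡ e b → a ≡ b) (e-vertex : ∀ {a} → Vert H a → Vert G (e a))
  (common : ∀ {a b} → Vert H a → Vert H b → Adj H a b →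
            ∃ λ m → Vert G m × Adj G (e a) m × Adj G m (e b)) where

  module Slots {n : ℕ} {K : Fin n → Fin n → Set} (f : Fin n → C)
               (onto : ∀ v → Vert G v → ∃ λ i → f i ≡ v)
               (reflects : ∀ i j → Adj G (f i) (f j) → K i j) where

    slot : ∀ {a} → Vert H a → Fin n
    slot a∈H = proj₁ (onto _ (e-vertex a∈H))

    slot-injective : ∀ {a b} (a∈H : Vert H a) (b∈H : Vert H b) → slot a∈H ≡ slot b∈H → a ≡ b
    slot-injective a∈H b∈H same = e-injective (begin
      e _              ≡⟨ sym (proj₂ (onto _ (e-vertex a∈H))) ⟩
      f (slot a∈H)     ≡⟨ cong f same ⟩
      f (slot b∈H)     ≡⟨ proj₂ (onto _ (e-vertex b∈H)) ⟩
      e _              ∎)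

    common-slot : ∀ {a b} (a∈H : Vert H a) (b∈H : Vert H b) → Adj H a b →
                  ∃ λ l → K (slot a∈H) l × K l (slot b∈H)
    common-slot a∈H b∈H ab with common a∈H b∈H ab
    ... | m , m∈G , am , mb with onto m m∈G
    ...   | l , refl = l , reflects _ _ (subst (λ v → Adj G v (f l)) (sym (proj₂ (onto _ (e-vertex a∈H)))) am)
                         , reflects _ _ (subst (Adj G (f l)) (sym (proj₂ (onto _ (e-vertex b∈H)))) mb)

  IsPath⇒Acyclic : IsPath G → Acyclic H
  IsPath⇒Acyclic (n , f , _ , _ , onto , _ , reflects) (x , xs , 3≤len , unique , x∈H ∷ xs∈H , closed) =
    StepTwo-not-closed (position x∈H) (All.reduce position xs∈H)
      (subst (Linked StepTwo) closed-positions
        (positions-linked cycle∈H (Linked.zip (closed-distinct xs unique xs≢[] , closed))))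
      (subst NonBacktracking closed-positions
        (positions-nonBacktracking cycle∈H (closed-nonBacktracking xs unique (≤-pred 3≤len))))
    where
      open Slots f onto reflects

      position : ∀ {a} → Vert H a → ℕ
      position a∈H = toℕ (slot a∈H)

      same-position : ∀ {a b} (a∈H : Vert H a) (b∈H : Vert H b) → position a∈H ≡ position b∈H → a ≡ b
      same-position a∈H b∈H = slot-injective a∈H b∈H ∘ toℕ-injective

      xs≢[] : xs ≢ []
      xs≢[] xs≡[] with s≤s () ← subst (λ ys → 3 ≤ length (x ∷ ys)) xs≡[] 3≤len

      cycle∈H = All.∷ʳ⁺ (x∈H ∷ xs∈H) x∈H

      closed-positions : All.reduce position cycle∈H ≡
                         (position x∈H ∷ All.reduce position xs∈H) ∷ʳ position x∈H
      closed-positions = reduce-∷ʳ⁺ position (x∈H ∷ xs∈H) x∈H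

      step : ∀ {a b} (a∈H : Vert H a) (b∈H : Vert H b) → a ≢ b → Adj H a b →
             StepTwo (position a∈H) (position b∈H)
      step a∈H b∈H a≢b ab with common-slot a∈H b∈H ab
      ... | _ , inj₁ a→l , inj₁ l→b = inj₁ (trans (sym l→b) (cong suc (sym a→l)))
      ... | _ , inj₂ l→a , inj₂ b→l = inj₂ (trans (sym l→a) (cong suc (sym b→l)))
      ... | _ , inj₁ a→l , inj₂ b→l = ⊥-elim (a≢b (same-position a∈H b∈H (suc-injective (trans a→l (sym b→l)))))
      ... | _ , inj₂ l→a , inj₁ l→b = ⊥-elim (a≢b (same-position a∈H b∈H (trans (sym l→a) l→b)))

      positions-linked : ∀ {zs} (zs∈H : All (Vert H) zs) → Linked (λ a b → a ≢ b × Adj H a b) zs →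
                         Linked StepTwo (All.reduce position zs∈H)
      positions-linked []                  []               = []
      positions-linked (_ ∷ [])            [-]              = [-]
      positions-linked (a∈H ∷ b∈H ∷ zs∈H) ((a≢b , ab) ∷ l) =
        step a∈H b∈H a≢b ab ∷ positions-linked (b∈H ∷ zs∈H) l

      positions-nonBacktracking : ∀ {zs} (zs∈H : All (Vert H) zs) → NonBacktracking zs →
                                  NonBacktracking (All.reduce position zs∈H)
      positions-nonBacktracking []                      _          = _
      positions-nonBacktracking (_ ∷ [])                _          = _
      positions-nonBacktracking (_ ∷ _ ∷ [])            _          = _
      positions-nonBacktracking (a∈H ∷ b∈H ∷ c∈H ∷ zs∈H) (a≢c , nb) =
        a≢c ∘ same-position a∈H c∈H ,
        positions-nonBacktracking (b∈H ∷ c∈H ∷ zs∈H) nb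

  IsoC4⇒Acyclic : IsoC4 G → Acyclic H
  IsoC4⇒Acyclic _ (_ , []     , s≤s () , _)
  IsoC4⇒Acyclic _ (_ , _ ∷ [] , s≤s (s≤s ()) , _)
  IsoC4⇒Acyclic (f , _ , _ , onto , _ , reflects)
                (x , y ∷ z ∷ _ , _ , (x≢y ∷ x≢z ∷ _) ∷ (y≢z ∷ _) ∷ _ ,
                 x∈H ∷ y∈H ∷ z∈H ∷ _ , xy ∷ yz ∷ _) =
    x≢z (slot-injective x∈H z∈H (begin
      slot x∈H                                     ≡⟨ sym (next⁴≡id _) ⟩
      next (next (next (next (slot x∈H))))         ≡⟨ cong (next ∘ next) (sym (opposite x∈H y∈H x≢y xy)) ⟩
      next (next (slot y∈H))                       ≡⟨ sym (opposite y∈H z∈H y≢z yz) ⟩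
      slot z∈H                                     ∎))
    where
      open Slots f onto reflects

      opposite : ∀ {a b} (a∈H : Vert H a) (b∈H : Vert H b) → a ≢ b → Adj H a b →
                 slot b∈H ≡ next (next (slot a∈H))
      opposite a∈H b∈H a≢b ab with common-slot a∈H b∈H ab
      ... | _ , al , lb = C4-common-neighbour al lb (a≢b ∘ slot-injective a∈H b∈H)

-- Maximal paths in graphs of maximum degree two

shrink : ∀ {a n} → suc a < n → a < n
shrink = <-trans (n<1+n _)

module PathInMaxDegree≤2 {C : Set} {G : Graph C} (adj-sym : SymmetricAdj G) (adj-irrefl : IrreflexiveAdj G)
         (degree : MaxDegree≤2 G) (_≟ᶜ_ : DecidableEquality C) {h : C} {t : List C} (unique : Unique (h ∷ t))
         (vertices : All (Vert G) (h ∷ t)) (linked : Linked (Adj G) (h ∷ t)) where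

  private
    n : ℕ
    n = suc (length t)

  at : (a : ℕ) → .(a < n) → C
  at a a<n = lookup (h ∷ t) (fromℕ< a<n)

  at-vertex : ∀ {a} .(a<n : a < n) → Vert G (at a a<n)
  at-vertex a<n = All.lookup vertices (∈-lookup (fromℕ< a<n))

  at-injective : ∀ {a b} .(a<n : a < n) .(b<n : b < n) → at a a<n ≡ at b b<n → a ≡ b
  at-injective {a} {b} a<n b<n e = begin
    a                ≡⟨ sym (toℕ-fromℕ< a<n) ⟩
    toℕ (fromℕ< a<n) ≡⟨ cong toℕ (lookup-injective unique _ _ e) ⟩
    toℕ (fromℕ< b<n) ≡⟨ toℕ-fromℕ< b<n ⟩
    b                ∎

  at-adjacent : ∀ a .(a<n : a < n) .(1+a<n : suc a < n) → Adj G (at a a<n) (at (suc a) 1+a<n)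
  at-adjacent a a<n 1+a<n =
    Linked⇒lookup linked _ _ (trans (cong suc (toℕ-fromℕ< a<n)) (sym (toℕ-fromℕ< 1+a<n)))

  interior-neighbour : ∀ a (2+a<n : 2 + a < n) {w} → Vert G w → Adj G (at (suc a) (shrink 2+a<n)) w →
                       w ≡ at a (shrink (shrink 2+a<n)) ⊎ w ≡ at (2 + a) 2+a<n
  interior-neighbour a 2+a<n {w} w∈G aw
    with w ≟ᶜ at a (shrink (shrink 2+a<n)) | w ≟ᶜ at (2 + a) 2+a<n
  ... | yes e | _     = inj₁ e
  ... | no  _ | yes e = inj₂ e
  ... | no w≢prev | no w≢next =
    ⊥-elim (degree (at-vertex 1+a<n) (at-vertex a<n) (at-vertex 2+a<n) w∈G
           (adj-sym (at-adjacent a a<n 1+a<n)) (at-adjacent (suc a) 1+a<n 2+a<n) aw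
           (λ e → <-irrefl (at-injective a<n 2+a<n e) (shrink (n<1+n (suc a))))
           (λ e → w≢prev (sym e)) (λ e → w≢next (sym e)))
    where 1+a<n = shrink 2+a<n
          a<n   = shrink 1+a<n

  lookup≡at : ∀ i → lookup (h ∷ t) i ≡ at (toℕ i) (toℕ<n i)
  lookup≡at i = cong (lookup (h ∷ t)) (sym (fromℕ<-toℕ i (toℕ<n i)))

  forward-edge : ∀ a b .(a<n : a < n) (b<n : b < n) → a < b → Adj G (at a a<n) (at b b<n) →
                 suc a ≡ b ⊎ EndPoints (length t) a b
  forward-edge a b _ _ _ _ with suc a ≟ b
  ... | yes 1+a≡b = inj₁ 1+a≡b
  forward-edge (suc a) b a<n b<n a<b ab | no 2+a≢b
    with interior-neighbour a (≤-<-trans a<b b<n) (at-vertex b<n) ab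
  ... | inj₁ b≡a   = ⊥-elim (<-irrefl (sym (at-injective b<n _ b≡a)) (shrink a<b))
  ... | inj₂ b≡2+a = ⊥-elim (2+a≢b (sym (at-injective b<n (≤-<-trans a<b b<n) b≡2+a)))
  forward-edge zero b _ b<n _ _ | no 1≢b with b ≟ length t
  ... | yes b≡last = inj₂ (inj₁ (refl , b≡last))
  forward-edge zero (suc zero) _ _ _ _ | no 1≢b | no _ = ⊥-elim (1≢b refl)
  forward-edge zero (suc (suc b)) a<n b<n _ ab | no _ | no b≢last
    with s≤s (≤∧≢⇒< (<-pred b<n) b≢last)
  ... | 3+b<n with interior-neighbour (suc b) 3+b<n (at-vertex a<n) (adj-sym ab)
  ...   | inj₁ 0≡b   = ⊥-elim (0≢1+n (at-injective a<n (shrink (shrink 3+b<n)) 0≡b))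
  ...   | inj₂ 0≡2+b = ⊥-elim (0≢1+n (at-injective a<n 3+b<n 0≡2+b))

  edges : ∀ i j → Adj G (lookup (h ∷ t) i) (lookup (h ∷ t) j) →
          PathAdj n i j ⊎ EndPoints (length t) (toℕ i) (toℕ j)
  edges i j ij with <-cmp (toℕ i) (toℕ j)
  ... | tri< i<j _ _ = Sum.map inj₁ id (forward-edge _ _ (toℕ<n i) (toℕ<n j) i<j
                         (subst₂ (Adj G) (lookup≡at i) (lookup≡at j) ij))
  ... | tri≈ _ i≡j _ = ⊥-elim (adj-irrefl (subst (λ k → Adj G (lookup (h ∷ t) i) (lookup (h ∷ t) k))
                         (sym (toℕ-injective i≡j)) ij))
  ... | tri> _ _ j<i = Sum.map inj₂ Sum.swap (forward-edge _ _ (toℕ<n j) (toℕ<n i) j<i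
                         (subst₂ (Adj G) (lookup≡at j) (lookup≡at i) (adj-sym ij)))

  module _ (head-saturated : Saturated G h (h ∷ t)) (last-saturated : Saturated G (lastOf h t) (h ∷ t))
           where

    saturated : ∀ {v} → v ∈ h ∷ t → Saturated G v (h ∷ t)
    saturated v∈P w w∈G vw with ∈⇒lookup v∈P
    ... | Fin.zero , refl = head-saturated w w∈G vw
    ... | Fin.suc i , refl with suc (toℕ i) ≟ length t
    ...   | yes i≡last = last-saturated w w∈G (subst (λ v → Adj G v w) (lookup-last h t i≡last) vw)
    ...   | no  i≢last with s≤s (≤∧≢⇒< (<-pred (toℕ<n (Fin.suc i))) i≢last)
    ...     | 2+i<n with interior-neighbour (toℕ i) 2+i<n w∈G
                                          (subst (λ v → Adj G v w) (lookup≡at (Fin.suc i)) vw)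
    ...       | inj₁ refl = ∈-lookup (fromℕ< (shrink (shrink 2+i<n)))
    ...       | inj₂ refl = ∈-lookup (fromℕ< 2+i<n)

    spans : Connected G → ∀ v → Vert G v → v ∈ h ∷ t
    spans connected v v∈G = along (here refl) (connected h v (All.lookup vertices (here refl)) v∈G)
      where
        along : ∀ {u} → u ∈ h ∷ t → Walk G u v → v ∈ h ∷ t
        along u∈P (here _)       = u∈P
        along u∈P (there _ uw w) = along (saturated u∈P _ (walk-start w) uw) w

record SpanningPath {C : Set} (G : Graph C) : Set where
  field
    head     : C
    tail     : List C
    unique   : Unique (head ∷ tail)
    vertices : All (Vert G) (head ∷ tail)
    linked   : Linked (Adj G) (head ∷ tail)
    spans    : ∀ v → Vert G v → v ∈ head ∷ tail
    edges    : ∀ i j → Adj G (lookup (head ∷ tail) i) (lookup (head ∷ tail) j) →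
               PathAdj (suc (length tail)) i j ⊎ EndPoints (length tail) (toℕ i) (toℕ j)

module _ {C : Set} {G : Graph C} (_≟ᶜ_ : DecidableEquality C)
         (vert? : ∀ u → Dec (Vert G u)) (adj? : ∀ u v → Dec (Adj G u v))
         (adj-sym : SymmetricAdj G) (adj-irrefl : IrreflexiveAdj G) (degree : MaxDegree≤2 G)
         (V : List C) (complete : ∀ u → Vert G u → u ∈ V) (connected : Connected G) where

  open import Data.List.Membership.DecPropositional _≟ᶜ_ using (_∈?_)

  private
    NewNeighbour : C → List C → C → Set
    NewNeighbour v P w = Vert G w × Adj G v w × w ∉ P

    newNeighbour? : ∀ v P → Dec (Any (NewNeighbour v P) V)
    newNeighbour? v P = any? (λ w → vert? w ×-dec adj? v w ×-dec ¬? (w ∈? P)) V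

    one-more : ∀ {m} k n → m < suc k + n → m < k + suc n
    one-more {m} k n = subst (m <_) (sym (+-suc k n))

    saturated : ∀ {v P} → ¬ Any (NewNeighbour v P) V → Saturated G v P
    saturated {P = P} none w w∈G vw with w ∈? P
    ... | yes w∈P = w∈P
    ... | no  w∉P = ⊥-elim (none (lose (complete w w∈G) (w∈G , vw , w∉P)))

  -- A path repeats no vertex of V, so fuel + its length > length V keeps the fuel from running out.
  extend : ∀ fuel {h t} → Unique (h ∷ t) → All (Vert G) (h ∷ t) → Linked (Adj G) (h ∷ t) →
           length V < fuel + length (h ∷ t) → SpanningPath G
  extend zero unique vertices _ V<P =
    ⊥-elim (<⇒≱ V<P (unique⊆⇒length≤ unique (λ {v} v∈P → complete v (All.lookup vertices v∈P))))
  extend (suc k) {h} {t} unique vertices linked V<P with newNeighbour? h (h ∷ t)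
  ... | yes new with find new
  ...   | w , _ , w∈G , hw , w∉P =
    extend k (¬Any⇒All¬ _ w∉P ∷ unique) (w∈G ∷ vertices) (adj-sym hw ∷ linked)
           (one-more k _ V<P)
  extend (suc k) {h} {t} unique vertices linked V<P | no head-saturated
    with newNeighbour? (lastOf h t) (h ∷ t)
  ... | yes new with find new
  ...   | w , _ , w∈G , lw , w∉P =
    extend k (Unique-∷ʳ⁺ unique w∉P) (All.∷ʳ⁺ vertices w∈G) (Linked-∷ʳ⁺ linked lw)
           (subst (λ m → length V < k + suc m) (sym (length-∷ʳ t)) (one-more k _ V<P))
  extend (suc k) {h} {t} unique vertices linked V<P | no head-saturated | no last-saturated = record
    { head = h ; tail = t ; unique = unique ; vertices = vertices ; linked = linked
    ; spans = PathInMaxDegree≤2.spans adj-sym adj-irrefl degree _≟ᶜ_ unique vertices linked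
                (saturated head-saturated) (saturated last-saturated) connected
    ; edges = PathInMaxDegree≤2.edges adj-sym adj-irrefl degree _≟ᶜ_ unique vertices linked }

  spanning-path : ∀ {v} → Vert G v → SpanningPath G
  spanning-path v∈G = extend (suc (length V)) ([] ∷ []) (v∈G ∷ []) [-] (s≤s (m≤m+n _ 1))

short-end-points : ∀ {m a b} → m ≤ 1 → EndPoints m a b → a ≡ b ⊎ (suc a ≡ b ⊎ suc b ≡ a)
short-end-points z≤n       (inj₁ (refl , refl)) = inj₁ refl
short-end-points z≤n       (inj₂ (refl , refl)) = inj₁ refl
short-end-points (s≤s z≤n) (inj₁ (refl , refl)) = inj₂ (inj₁ refl)
short-end-points (s≤s z≤n) (inj₂ (refl , refl)) = inj₂ (inj₂ refl)

module _ {C : Set} {G : Graph C} (adj-sym : SymmetricAdj G) (P : SpanningPath G) where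
  open SpanningPath P

  closing-edge : ∀ i j → EndPoints (length tail) (toℕ i) (toℕ j) →
                 Adj G (lookup (head ∷ tail) i) (lookup (head ∷ tail) j) → Adj G (lastOf head tail) head
  closing-edge i j (inj₁ (i≡0 , j≡last)) ij =
    adj-sym (subst₂ (Adj G) (lookup-head head tail i≡0) (lookup-last head tail j≡last) ij)
  closing-edge i j (inj₂ (j≡0 , i≡last)) ij =
    subst₂ (Adj G) (lookup-last head tail i≡last) (lookup-head head tail j≡0) ij

  spanning-path⇒IsPath : IrreflexiveAdj G → (Adj G (lastOf head tail) head → length tail ≤ 1) → IsPath G
  spanning-path⇒IsPath adj-irrefl short =
    suc (length tail) , lookup (head ∷ tail) , lookup-injective unique ,
    (λ i → All.lookup vertices (∈-lookup i)) , (λ v v∈G → ∈⇒lookup (spans v v∈G)) ,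
    preserves , reflects
    where
      preserves : ∀ i j → PathAdj _ i j → Adj G (lookup (head ∷ tail) i) (lookup (head ∷ tail) j)
      preserves i j (inj₁ i→j) = Linked⇒lookup linked i j i→j
      preserves i j (inj₂ j→i) = adj-sym (Linked⇒lookup linked j i j→i)

      reflects : ∀ i j → Adj G (lookup (head ∷ tail) i) (lookup (head ∷ tail) j) → PathAdj _ i j
      reflects i j ij with edges i j ij
      ... | inj₁ i~j = i~j
      ... | inj₂ ends with short-end-points (short (closing-edge i j ends ij)) ends
      ...   | inj₂ i~j = i~j
      ...   | inj₁ i≡j = ⊥-elim (adj-irrefl (subst (λ k → Adj G (lookup (head ∷ tail) i) (lookup (head ∷ tail) k))
                                               (sym (toℕ-injective i≡j)) ij))

  spanning-path⇒Cycle : Adj G (lastOf head tail) head → 2 ≤ length tail → Cycle G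
  spanning-path⇒Cycle closing long = head , tail , s≤s long , unique , vertices , Linked-∷ʳ⁺ linked closing

module _ {C : Set} {G : Graph C} (adj-sym : SymmetricAdj G) where

  spanning-path⇒IsoC4 : (P : SpanningPath G) → let open SpanningPath P in
                        Adj G (lastOf head tail) head → length tail ≡ 3 → IsoC4 G
  spanning-path⇒IsoC4 P@record { head = h ; tail = a ∷ b ∷ c ∷ [] ; linked = ha ∷ ab ∷ bc ∷ [-] } ch refl =
    lookup (h ∷ a ∷ b ∷ c ∷ []) , lookup-injective unique ,
    (λ i → All.lookup vertices (∈-lookup i)) , (λ v v∈G → ∈⇒lookup (spans v v∈G)) ,
    preserves , (λ i j ij → path-or-ends⇒C4Adj (edges i j ij))
    where
      open SpanningPath P
      f = lookup (h ∷ a ∷ b ∷ c ∷ [])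

      to-next : ∀ i → Adj G (f i) (f (next i))
      to-next 0F = ha
      to-next 1F = ab
      to-next 2F = bc
      to-next 3F = ch

      preserves : ∀ i j → C4Adj i j → Adj G (f i) (f j)
      preserves i j ij with C4Adj⇒next ij
      ... | inj₁ refl = to-next i
      ... | inj₂ refl = adj-sym (to-next j)

prime>1 : ∀ {p} → Prime p → 1 < p
prime>1 {p} p-prime = nonTrivial⇒n>1 p {{prime⇒nonTrivial p-prime}}

prime∣⇒≢1 : ∀ {p x} → Prime p → p ∣ x → x ≢ 1
prime∣⇒≢1 p-prime p∣x refl = <⇒≢ (prime>1 p-prime) (sym (∣1⇒≡1 p∣x))

prime-divisor : ∀ {n} → 1 < n → ∃ λ p → Prime p × p ∣ n
prime-divisor {1} (s≤s ())
prime-divisor {suc (suc k)} _ with factorise (suc (suc k))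
... | record { factors = p ∷ ps ; isFactorisation = n≡p*ps ; factorsPrime = p-prime ∷ _ } =
  p , p-prime , divides (product ps) (trans n≡p*ps (*-comm p (product ps)))

common-prime⇒gcd>1 : ∀ {p a b} → Prime p → 0 < a → p ∣ a → p ∣ b → 1 < gcd a b
common-prime⇒gcd>1 {p} {suc a} {b} p-prime _ p∣a p∣b =
  ≤-trans (prime>1 p-prime) (∣⇒≤ {{≢-nonZero (gcd[m,n]≢0 (suc a) b (inj₁ λ ()))}} (gcd-greatest p∣a p∣b))

gcd>1⇒common-prime : ∀ a b → 1 < gcd a b → ∃ λ p → Prime p × p ∣ a × p ∣ b
gcd>1⇒common-prime a b gcd>1 with prime-divisor gcd>1
... | p , p-prime , p∣gcd = p , p-prime , ∣-trans p∣gcd (gcd[m,n]∣m a b) , ∣-trans p∣gcd (gcd[m,n]∣n a b)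

distinct-primes-coprime : ∀ {p q} → Prime p → Prime q → p ≢ q → Coprime p q
distinct-primes-coprime p-prime q-prime p≢q (d∣p , d∣q)
  with prime⇒irreducible p-prime d∣p | prime⇒irreducible q-prime d∣q
... | inj₁ d≡1 | _        = d≡1
... | inj₂ _   | inj₁ d≡1 = d≡1
... | inj₂ d≡p | inj₂ d≡q = ⊥-elim (p≢q (trans (sym d≡p) d≡q))

coprime-divisors⇒*∣ : ∀ {m n x} → Coprime m n → m ∣ x → n ∣ x → m * n ∣ x
coprime-divisors⇒*∣ {m} {n} coprime m∣x n∣x = subst (_∣ _) lcm≡m*n (lcm-least m∣x n∣x)
  where
    lcm≡m*n : lcm m n ≡ m * n
    lcm≡m*n = begin
      lcm m n            ≡⟨ sym (*-identityˡ (lcm m n)) ⟩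
      1 * lcm m n        ≡⟨ cong (_* lcm m n) (sym (coprime⇒gcd≡1 coprime)) ⟩
      gcd m n * lcm m n  ≡⟨ gcd*lcm m n ⟩
      m * n              ∎

distinct-primes⇒*∣ : ∀ {p q x} → Prime p → Prime q → p ≢ q → p ∣ x → q ∣ x → p * q ∣ x
distinct-primes⇒*∣ p-prime q-prime p≢q = coprime-divisors⇒*∣ (distinct-primes-coprime p-prime q-prime p≢q)

-- The graphs B(X), Γ(X) and Δ(X)

elements : List (ℕ ⊎ ℕ) → List ℕ
elements []           = []
elements (inj₁ _ ∷ us) = elements us
elements (inj₂ x ∷ us) = x ∷ elements us

elements-∈ : ∀ {x} us → x ∈ elements us → inj₂ x ∈ us
elements-∈ (inj₁ _ ∷ us) x∈ = there (elements-∈ us x∈)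
elements-∈ (inj₂ _ ∷ us) (here refl) = here refl
elements-∈ (inj₂ _ ∷ us) (there x∈) = there (elements-∈ us x∈)

elements-unique : ∀ us → Unique us → Unique (elements us)
elements-unique []            _             = []
elements-unique (inj₁ _ ∷ us) (_ ∷ unique)  = elements-unique us unique
elements-unique (inj₂ x ∷ us) (x∉ ∷ unique) =
  All.tabulate (λ y∈ x≡y → All.lookup x∉ (elements-∈ us y∈) (cong inj₂ x≡y)) ∷ elements-unique us unique

elements-∷ʳ : ∀ us {x} → elements (us ∷ʳ inj₂ x) ≡ elements us ∷ʳ x
elements-∷ʳ []            = refl
elements-∷ʳ (inj₁ _ ∷ us) = elements-∷ʳ us
elements-∷ʳ (inj₂ y ∷ us) = cong (y ∷_) (elements-∷ʳ us)

BAdj? : ∀ u v → Dec (BAdj u v)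
BAdj? (inj₁ p) (inj₂ x) = p ∣? x
BAdj? (inj₂ x) (inj₁ p) = p ∣? x
BAdj? (inj₁ _) (inj₁ _) = no λ ()
BAdj? (inj₂ _) (inj₂ _) = no λ ()

module _ (X : List ℕ) where

  B-adj-sym : SymmetricAdj (B X)
  B-adj-sym {inj₁ _} {inj₂ _} p∣x = p∣x
  B-adj-sym {inj₂ _} {inj₁ _} p∣x = p∣x

  B-adj-irrefl : IrreflexiveAdj (B X)
  B-adj-irrefl {inj₁ _} ()
  B-adj-irrefl {inj₂ _} ()

  BVert? : ∀ u → Dec (BVert X u)
  BVert? (inj₂ x) = (x ∈ℕ? X) ×-dec ¬? (x ≟ 1)
  BVert? (inj₁ p) = prime? p ×-dec map′ find (λ (x , x∈X , p∣x) → lose x∈X p∣x) (any? (p ∣?_) X)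

  candidates : List (ℕ ⊎ ℕ)
  candidates = concatMap (λ x → inj₂ x ∷ map inj₁ (upTo (suc x))) X

  walk-to-element : ∀ u → BVert X u → ∃ λ x → InStar X x × Walk (B X) u (inj₂ x)
  walk-to-element (inj₂ x) x∈B                           = x , x∈B , here x∈B
  walk-to-element (inj₁ p) p∈B@(p-prime , x , x∈X , p∣x) = x , x∈Γ , there p∈B p∣x (here x∈Γ)
    where x∈Γ = x∈X , prime∣⇒≢1 p-prime p∣x

  Γ-walk⇒B-walk : ∀ {x y} → Walk (Γ X) x y → Walk (B X) (inj₂ x) (inj₂ y)
  Γ-walk⇒B-walk (here x∈Γ) = here x∈Γ
  Γ-walk⇒B-walk {x} (there {v = y} x∈Γ (_ , gcd>1) w) with gcd>1⇒common-prime x y gcd>1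
  ... | p , p-prime , p∣x , p∣y =
    there {v = inj₁ p} x∈Γ p∣x (there (p-prime , x , proj₁ x∈Γ , p∣x) p∣y (Γ-walk⇒B-walk w))

  Γ-connected⇒B-connected : Connected (Γ X) → Connected (B X)
  Γ-connected⇒B-connected Γ-connected u v u∈B v∈B with walk-to-element u u∈B | walk-to-element v v∈B
  ... | x , x∈Γ , u⇝x | y , y∈Γ , v⇝y =
    u⇝x ++ʷ (Γ-walk⇒B-walk (Γ-connected x y x∈Γ y∈Γ) ++ʷ reverseʷ B-adj-sym v⇝y)

  module _ (positive : All (0 <_) X) where

    shared-prime⇒gcd>1 : ∀ {p a b} → Prime p → InStar X a → p ∣ a → p ∣ b → 1 < gcd a b
    shared-prime⇒gcd>1 p-prime (a∈X , _) = common-prime⇒gcd>1 p-prime (All.lookup positive a∈X)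

    candidates-complete : ∀ u → BVert X u → u ∈ candidates
    candidates-complete (inj₂ x) (x∈X , _) = ∈-concatMap⁺ _ (lose x∈X (here refl))
    candidates-complete (inj₁ p) (_ , x , x∈X , p∣x) =
      ∈-concatMap⁺ _ (lose x∈X (there (∈-map⁺ inj₁ (∈-upTo⁺ (s≤s p≤x)))))
      where p≤x = ∣⇒≤ {{>-nonZero (All.lookup positive x∈X)}} p∣x

    B-walk⇒Γ-walk : ∀ {x y} → Walk (B X) (inj₂ x) (inj₂ y) → Walk (Γ X) x y
    B-walk⇒Γ-walk (here x∈B) = here x∈B
    B-walk⇒Γ-walk {x} (there {v = inj₁ p} x∈B p∣x (there {v = inj₂ z} p∈B p∣z w)) with x ≟ z
    ... | yes refl = B-walk⇒Γ-walk w
    ... | no  x≢z  = there x∈B (x≢z , shared-prime⇒gcd>1 (proj₁ p∈B) x∈B p∣x p∣z)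
                           (B-walk⇒Γ-walk w)

    B-walk⇒Δ-walk : ∀ {p q} → Walk (B X) (inj₁ p) (inj₁ q) → Walk (Δ X) p q
    B-walk⇒Δ-walk (here p∈B) = here p∈B
    B-walk⇒Δ-walk {p} (there {v = inj₂ x} p∈B p∣x (there {v = inj₁ r} x∈B r∣x w)) with p ≟ r
    ... | yes refl = B-walk⇒Δ-walk w
    ... | no  p≢r  = there p∈B (p≢r , x , proj₁ x∈B ,
                                distinct-primes⇒*∣ (proj₁ p∈B) (proj₁ (walk-start w)) p≢r p∣x r∣x)
                           (B-walk⇒Δ-walk w)

    B-max-degree≤2 : Acyclic (Γ X) → Acyclic (Δ X) → MaxDegree≤2 (B X)
    B-max-degree≤2 _ Δ-acyclic {inj₂ x} {inj₁ p} {inj₁ q} {inj₁ r} x∈B p∈B q∈B r∈B p∣x q∣x r∣x p≢q p≢r q≢r =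
      Δ-acyclic (triangle⇒Cycle p≢q′ p≢r′ q≢r′ p∈B q∈B r∈B (Δ-edge p∈B q∈B p≢q′ p∣x q∣x)
                 (Δ-edge q∈B r∈B q≢r′ q∣x r∣x) (Δ-edge r∈B p∈B (p≢r′ ∘ sym) r∣x p∣x))
      where
        p≢q′ = p≢q ∘ cong inj₁
        p≢r′ = p≢r ∘ cong inj₁
        q≢r′ = q≢r ∘ cong inj₁
        Δ-edge : ∀ {s t} → InRho X s → InRho X t → s ≢ t → s ∣ x → t ∣ x → Adj (Δ X) s t
        Δ-edge s∈Δ t∈Δ s≢t s∣x t∣x =
          s≢t , x , proj₁ x∈B , distinct-primes⇒*∣ (proj₁ s∈Δ) (proj₁ t∈Δ) s≢t s∣x t∣x
    B-max-degree≤2 Γ-acyclic _ {inj₁ p} {inj₂ x} {inj₂ y} {inj₂ z} p∈B x∈B y∈B z∈B p∣x p∣y p∣z x≢y x≢z y≢z =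
      Γ-acyclic (triangle⇒Cycle x≢y′ x≢z′ y≢z′ x∈B y∈B z∈B (x≢y′ , Γ-edge x∈B p∣x p∣y)
                 (y≢z′ , Γ-edge y∈B p∣y p∣z) (x≢z′ ∘ sym , Γ-edge z∈B p∣z p∣x))
      where
        x≢y′ = x≢y ∘ cong inj₂
        x≢z′ = x≢z ∘ cong inj₂
        y≢z′ = y≢z ∘ cong inj₂
        Γ-edge : ∀ {s t} → InStar X s → p ∣ s → p ∣ t → 1 < gcd s t
        Γ-edge s∈Γ = shared-prime⇒gcd>1 (proj₁ p∈B) s∈Γ

    elements-in-Γ : ∀ us → All (BVert X) us → All (InStar X) (elements us)
    elements-in-Γ []            _            = []
    elements-in-Γ (inj₁ _ ∷ us) (_ ∷ us∈B)   = elements-in-Γ us us∈B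
    elements-in-Γ (inj₂ _ ∷ us) (x∈Γ ∷ us∈B) = x∈Γ ∷ elements-in-Γ us us∈B

    elements-linked : ∀ {x} us → Linked BAdj (inj₂ x ∷ us) → All (BVert X) (inj₂ x ∷ us) →
                      Linked (λ a b → 1 < gcd a b) (x ∷ elements us)
    elements-linked []                         _                 _                         = [-]
    elements-linked (inj₁ p ∷ [])              _                 _                         = [-]
    elements-linked (inj₂ _ ∷ _)               (() ∷ _)          _
    elements-linked (inj₁ _ ∷ inj₁ _ ∷ _)      (_ ∷ () ∷ _)      _
    elements-linked (inj₁ p ∷ inj₂ y ∷ us) (p∣x ∷ p∣y ∷ chain) (x∈B ∷ p∈B ∷ us∈B) =
      shared-prime⇒gcd>1 (proj₁ p∈B) x∈B p∣x p∣y ∷ elements-linked us chain us∈B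

    element-cycle-length : Acyclic (Γ X) → ∀ {x vs} → 3 ≤ length (inj₂ x ∷ vs) → Unique (inj₂ x ∷ vs) →
                           All (BVert X) (inj₂ x ∷ vs) → Linked BAdj ((inj₂ x ∷ vs) ∷ʳ inj₂ x) →
                           length (inj₂ x ∷ vs) ≡ 4
    element-cycle-length _ {vs = []}                                   (s≤s ()) _ _ _
    element-cycle-length _ {vs = _ ∷ []}                               (s≤s (s≤s ())) _ _ _
    element-cycle-length _ {vs = _ ∷ _ ∷ _ ∷ []}                       _ _ _ _ = refl
    element-cycle-length _ {vs = inj₂ _ ∷ _}                           _ _ _ (() ∷ _)
    element-cycle-length _ {vs = inj₁ _ ∷ inj₁ _ ∷ _}                  _ _ _ (_ ∷ () ∷ _)
    element-cycle-length _ {vs = inj₁ _ ∷ inj₂ _ ∷ []}                 _ _ _ (_ ∷ _ ∷ () ∷ _)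
    element-cycle-length _ {vs = inj₁ _ ∷ inj₂ _ ∷ inj₂ _ ∷ _ ∷ _}     _ _ _ (_ ∷ _ ∷ () ∷ _)
    element-cycle-length _ {vs = inj₁ _ ∷ inj₂ _ ∷ inj₁ _ ∷ inj₁ _ ∷ _} _ _ _ (_ ∷ _ ∷ _ ∷ () ∷ _)
    element-cycle-length Γ-acyclic {x} {vs@(inj₁ _ ∷ inj₂ _ ∷ inj₁ _ ∷ inj₂ _ ∷ _)} _ unique cycle∈B chain =
      ⊥-elim (Γ-acyclic (x , elements vs , s≤s (s≤s (s≤s z≤n)) , x∷ys-unique ,
                         elements-in-Γ (inj₂ x ∷ vs) cycle∈B ,
                         Linked.zip (closed-distinct (elements vs) x∷ys-unique (λ ()) , gcd-chain)))
      where
        x∷ys-unique = elements-unique (inj₂ x ∷ vs) unique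
        gcd-chain : Linked (λ a b → 1 < gcd a b) ((x ∷ elements vs) ∷ʳ x)
        gcd-chain = subst (λ ys → Linked (λ a b → 1 < gcd a b) (x ∷ ys)) (elements-∷ʳ vs)
                          (elements-linked (vs ∷ʳ inj₂ x) chain (All.∷ʳ⁺ cycle∈B (All.head cycle∈B)))

    B-cycle-length : Acyclic (Γ X) → (c : Cycle (B X)) → cycle-length c ≡ 4
    B-cycle-length Γ-acyclic (inj₂ x , vs , 3≤len , unique , cycle∈B , chain) =
      element-cycle-length Γ-acyclic 3≤len unique cycle∈B chain
    B-cycle-length Γ-acyclic (inj₁ p , [] , s≤s () , _)
    B-cycle-length Γ-acyclic (inj₁ p , inj₁ _ ∷ _ , _ , _ , _ , () ∷ _)
    B-cycle-length Γ-acyclic (inj₁ p , inj₂ x ∷ ws , s≤s 2≤len , unique , cycle∈B , chain)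
      with rotate unique cycle∈B chain
    ... | unique′ , cycle∈B′ , chain′ = begin
      suc (suc (length ws))        ≡⟨ cong suc (sym (length-∷ʳ ws)) ⟩
      suc (length (ws ∷ʳ inj₁ p))  ≡⟨ element-cycle-length Γ-acyclic 3≤len′ unique′ cycle∈B′ chain′ ⟩
      4                            ∎
      where 3≤len′ = s≤s (subst (2 ≤_) (sym (length-∷ʳ ws)) 2≤len)

    Γ-common-neighbour : ∀ {x y} → InStar X x → InStar X y → Adj (Γ X) x y →
                         ∃ λ m → BVert X m × BAdj (inj₂ x) m × BAdj m (inj₂ y)
    Γ-common-neighbour {x} {y} x∈Γ _ (_ , gcd>1) with gcd>1⇒common-prime x y gcd>1
    ... | p , p-prime , p∣x , p∣y = inj₁ p , (p-prime , x , proj₁ x∈Γ , p∣x) , p∣x , p∣y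

    Δ-common-neighbour : ∀ {p q} → InRho X p → InRho X q → Adj (Δ X) p q →
                         ∃ λ m → BVert X m × BAdj (inj₁ p) m × BAdj m (inj₁ q)
    Δ-common-neighbour {p} {q} p∈Δ _ (_ , x , x∈X , pq∣x) =
      inj₂ x , (x∈X , prime∣⇒≢1 (proj₁ p∈Δ) (m*n∣⇒m∣ p q pq∣x)) , m*n∣⇒m∣ p q pq∣x , m*n∣⇒n∣ p q pq∣x

    path-or-C4⇒trees : IsPath (B X) ⊎ IsoC4 (B X) → IsTree (Γ X) × IsTree (Δ X)
    path-or-C4⇒trees shape = (Γ-connected , Γ-acyclic) , (Δ-connected , Δ-acyclic)
      where
        module ΓB = TwoStepEmbedding {G = B X} {H = Γ X} inj₂ inj₂-injective id Γ-common-neighbour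
        module ΔB = TwoStepEmbedding {G = B X} {H = Δ X} inj₁ inj₁-injective id Δ-common-neighbour

        B-connected : Connected (B X)
        B-connected = Sum.[ IsPath⇒Connected B-adj-sym , IsoC4⇒Connected B-adj-sym ]′ shape

        Γ-connected : Connected (Γ X)
        Γ-connected x y x∈Γ y∈Γ = B-walk⇒Γ-walk (B-connected (inj₂ x) (inj₂ y) x∈Γ y∈Γ)

        Δ-connected : Connected (Δ X)
        Δ-connected p q p∈Δ q∈Δ = B-walk⇒Δ-walk (B-connected (inj₁ p) (inj₁ q) p∈Δ q∈Δ)

        Γ-acyclic : Acyclic (Γ X)
        Γ-acyclic = Sum.[ ΓB.IsPath⇒Acyclic , ΓB.IsoC4⇒Acyclic ]′ shape

        Δ-acyclic : Acyclic (Δ X)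
        Δ-acyclic = Sum.[ ΔB.IsPath⇒Acyclic , ΔB.IsoC4⇒Acyclic ]′ shape

    spanning-path⇒path-or-C4 : Acyclic (Γ X) → SpanningPath (B X) → IsPath (B X) ⊎ IsoC4 (B X)
    spanning-path⇒path-or-C4 Γ-acyclic P = classify (BAdj? (lastOf head tail) head) (length tail ≤? 1)
      where
        open SpanningPath P

        classify : Dec (BAdj (lastOf head tail) head) → Dec (length tail ≤ 1) → IsPath (B X) ⊎ IsoC4 (B X)
        classify (no  unclosed) _          = inj₁ (spanning-path⇒IsPath B-adj-sym P B-adj-irrefl (⊥-elim ∘ unclosed))
        classify (yes _)        (yes short) = inj₁ (spanning-path⇒IsPath B-adj-sym P B-adj-irrefl (λ _ → short))
        classify (yes closing)  (no  long)  = inj₂ (spanning-path⇒IsoC4 B-adj-sym P closing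
          (suc-injective (B-cycle-length Γ-acyclic (spanning-path⇒Cycle B-adj-sym P closing (≰⇒> long)))))

    trees⇒path-or-C4 : (∃ λ x → InStar X x) → IsTree (Γ X) × IsTree (Δ X) → IsPath (B X) ⊎ IsoC4 (B X)
    trees⇒path-or-C4 (x , x∈Γ) ((Γ-connected , Γ-acyclic) , (_ , Δ-acyclic)) =
      spanning-path⇒path-or-C4 Γ-acyclic
        (spanning-path (≡-dec _≟_ _≟_) BVert? BAdj? B-adj-sym B-adj-irrefl
                       (B-max-degree≤2 Γ-acyclic Δ-acyclic) candidates candidates-complete
                       (Γ-connected⇒B-connected Γ-connected) {inj₂ x} x∈Γ)

-- X ≢ [] is implied by the element of X that is not 1.
corollary4p3 : (X : List ℕ) → All (0 <_) X → X ≢ [] → (∃ λ x → x ∈ X × x ≢ 1) →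
    ((IsTree (Γ X) × IsTree (Δ X)) → (IsPath (B X) ⊎ IsoC4 (B X)))
    × ((IsPath (B X) ⊎ IsoC4 (B X)) → (IsTree (Γ X) × IsTree (Δ X)))
corollary4p3 X positive _ element = trees⇒path-or-C4 X positive element , path-or-C4⇒trees X positive
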